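{- Fix a positive integer $b$ and let $S_b = \{(x,y,z)\in\mathbb{Z}_{>0}^3 : (x+y+z)^2 = bxyz\}$. If $S_b$ is nonempty, then $S_b$ contains a Vieta-reduced solution, i.e. an element $(x,y,z)$ with $x\le y\le z\le x+y$. -}

module Defs where

open import Data.Nat using (ℕ; _+_; _*_; _≤_; _<_)
open import Data.Product using (_×_)
open import Relation.Binary.PropositionalEquality using (_≡_)

InS : ℕ → ℕ → ℕ → ℕ → Set
InS b x y z = (0 < x × 0 < y × 0 < z) × ((x + y + z) * (x + y + z) ≡ b * x * y * z)

VietaReduced : ℕ → ℕ → ℕ → Set
VietaReduced x y z = x ≤ y × y ≤ z × z ≤ x + y

{-# OPTIONS --safe #-}
-- Vieta jumping. For fixed x and y, a solution z is a root of the quadratic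
-- (s + t)² = P t in t, where s = x + y and P = b x y. Its other root w
-- satisfies w z = s², so w is again a positive integer, and w < z as soon
-- as s < z. Hence a sorted solution that is not Vieta-reduced can be
-- replaced by one with smaller sum, and descent on the sum ends in a
-- Vieta-reduced solution.
module Submission where

open import Defs
open import Data.Nat using (ℕ; _+_; _*_; _∸_; _≤_; _<_; _>_; _≤?_; >-nonZero)
open import Data.Nat.Properties
open import Data.Nat.Induction using (<-rec)
open import Data.Nat.Tactic.RingSolver using (solve-∀)
open import Data.Product using (_×_; ∃-syntax; _,_)
open import Data.Sum using (inj₁; inj₂)
open import Relation.Nullary using (yes; no)
open import Relation.Binary.PropositionalEquality

Sorted : ℕ → ℕ → ℕ → Set
Sorted x y z = x ≤ y × y ≤ z

module _ {P : ℕ → ℕ → ℕ → Set}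
         (swap₁₂ : ∀ {x y z} → P x y z → P y x z)
         (swap₂₃ : ∀ {x y z} → P x y z → P x z y) where

  insert-last : ∀ {x y z} → P x y z → x ≤ y → ∃[ x ] ∃[ y ] ∃[ z ] (P x y z × Sorted x y z)
  insert-last {x} {y} {z} p x≤y with ≤-total y z | ≤-total x z
  ... | inj₁ y≤z | _        = x , y , z , p , x≤y , y≤z
  ... | inj₂ z≤y | inj₁ x≤z = x , z , y , swap₂₃ p , x≤z , z≤y
  ... | inj₂ z≤y | inj₂ z≤x = z , x , y , swap₁₂ (swap₂₃ p) , z≤x , x≤y

  sort-triple : ∀ {x y z} → P x y z → ∃[ x ] ∃[ y ] ∃[ z ] (P x y z × Sorted x y z)
  sort-triple {x} {y} p with ≤-total x y
  ... | inj₁ x≤y = insert-last p x≤y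
  ... | inj₂ y≤x = insert-last (swap₁₂ p) y≤x

sum-swap₁₂ : ∀ x y z → x + y + z ≡ y + x + z
sum-swap₁₂ = solve-∀

sum-swap₂₃ : ∀ x y z → x + y + z ≡ x + z + y
sum-swap₂₃ = solve-∀

InS-swap₁₂ : ∀ b {x y z} → InS b x y z → InS b y x z
InS-swap₁₂ b {x} {y} {z} ((x>0 , y>0 , z>0) , eq) =
  (y>0 , x>0 , z>0) , subst₂ (λ s p → s * s ≡ p) (sum-swap₁₂ x y z) (product-swap b x y z) eq
  where
  product-swap : ∀ b x y z → b * x * y * z ≡ b * y * x * z
  product-swap = solve-∀

InS-swap₂₃ : ∀ b {x y z} → InS b x y z → InS b x z y
InS-swap₂₃ b {x} {y} {z} ((x>0 , y>0 , z>0) , eq) =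
  (x>0 , z>0 , y>0) , subst₂ (λ s p → s * s ≡ p) (sum-swap₂₃ x y z) (product-swap b x y z) eq
  where
  product-swap : ∀ b x y z → b * x * y * z ≡ b * x * z * y
  product-swap = solve-∀

square-expand : ∀ s t → (s + t) * (s + t) ≡ s * s + (s + s + t) * t
square-expand = solve-∀

-- The other root is P ∸ (2s + z) by Vieta's formula for the sum of the roots.
vieta-other-root : ∀ {s P z} → z > 0 → (s + z) * (s + z) ≡ P * z →
                   ∃[ w ] (w * z ≡ s * s × (s + w) * (s + w) ≡ P * w)
vieta-other-root {s} {P} {z} z>0 eq = w , w*z≡s² , root
  where
  open ≡-Reasoning
  c = s + s + z
  w = P ∸ c

  s²+cz≡Pz : s * s + c * z ≡ P * z
  s²+cz≡Pz = trans (sym (square-expand s z)) eq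

  c≤P : c ≤ P
  c≤P = *-cancelʳ-≤ c P z {{>-nonZero z>0}} (≤-trans (m≤n+m (c * z) (s * s)) (≤-reflexive s²+cz≡Pz))

  w+c≡P : w + c ≡ P
  w+c≡P = m∸n+n≡m c≤P

  w*z≡s² : w * z ≡ s * s
  w*z≡s² = sym (+-cancelʳ-≡ (c * z) (s * s) (w * z) (begin
    s * s + c * z  ≡⟨ s²+cz≡Pz ⟩
    P * z          ≡⟨ cong (_* z) (sym w+c≡P) ⟩
    (w + c) * z    ≡⟨ *-distribʳ-+ z w c ⟩
    w * z + c * z  ∎))

  root : (s + w) * (s + w) ≡ P * w
  root = begin
    (s + w) * (s + w)          ≡⟨ square-expand s w ⟩
    s * s + (s + s + w) * w    ≡⟨ cong (_+ (s + s + w) * w) (sym w*z≡s²) ⟩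
    w * z + (s + s + w) * w    ≡⟨ collect s w z ⟩
    (w + c) * w                ≡⟨ cong (_* w) w+c≡P ⟩
    P * w                      ∎
    where
    collect : ∀ s w z → w * z + (s + s + w) * w ≡ (w + (s + s + z)) * w
    collect = solve-∀

InS-vieta-jump : ∀ b {x y z} → InS b x y z → x + y < z → ∃[ w ] (InS b x y w × w < z)
InS-vieta-jump b {x} {y} {z} ((x>0 , y>0 , z>0) , eq) x+y<z
  with vieta-other-root {x + y} {b * x * y} z>0 eq
... | w , w*z≡s² , root = w , ((x>0 , y>0 , w>0) , root) , w<z
  where
  x+y>0 : x + y > 0
  x+y>0 = ≤-trans x>0 (m≤m+n x y)
  w>0 : w > 0
  w>0 = *-cancelʳ-< z 0 w (subst (0 <_) (sym w*z≡s²) (*-mono-< x+y>0 x+y>0))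
  w<z : w < z
  w<z = *-cancelʳ-< z w z (subst (_< z * z) (sym w*z≡s²) (*-mono-< x+y<z x+y<z))

ReducedSolution : ℕ → Set
ReducedSolution b = ∃[ x ] ∃[ y ] ∃[ z ] (InS b x y z × VietaReduced x y z)

InS-with-sum : ℕ → ℕ → ℕ → ℕ → ℕ → Set
InS-with-sum b n x y z = InS b x y z × x + y + z ≡ n

InS-with-sum-swap₁₂ : ∀ b {n x y z} → InS-with-sum b n x y z → InS-with-sum b n y x z
InS-with-sum-swap₁₂ b {x = x} {y} {z} (p , e) = InS-swap₁₂ b p , trans (sym (sum-swap₁₂ x y z)) e

InS-with-sum-swap₂₃ : ∀ b {n x y z} → InS-with-sum b n x y z → InS-with-sum b n x z y
InS-with-sum-swap₂₃ b {x = x} {y} {z} (p , e) = InS-swap₂₃ b p , trans (sym (sum-swap₂₃ x y z)) e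

Reducible : ℕ → ℕ → Set
Reducible b n = ∀ {x y z} → InS b x y z → x + y + z ≡ n → ReducedSolution b

reducible-step : ∀ b n → (∀ {m} → m < n → Reducible b m) → Reducible b n
reducible-step b n descend p e
  with x , y , z , (p′ , e′) , x≤y , y≤z
         ← sort-triple (InS-with-sum-swap₁₂ b) (InS-with-sum-swap₂₃ b) (p , e)
  with z ≤? x + y
... | yes z≤x+y = x , y , z , p′ , x≤y , y≤z , z≤x+y
... | no z≰x+y with w , q , w<z ← InS-vieta-jump b p′ (≰⇒> z≰x+y) =
  descend (subst (x + y + w <_) e′ (+-monoʳ-< (x + y) w<z)) q refl

reducible : ∀ b n → Reducible b n
reducible b = <-rec (Reducible b) (reducible-step b)

-- The hypothesis 0 < b is redundant: for b = 0 there are no positive solutions.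
lemma5p4 : (b : ℕ) → 0 < b →
    ∃[ x ] ∃[ y ] ∃[ z ] InS b x y z →
    ∃[ x ] ∃[ y ] ∃[ z ] (InS b x y z × VietaReduced x y z)
lemma5p4 b _ (x , y , z , p) = reducible b (x + y + z) p refl
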